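{- Let $q$ be a prime power, $n\ge 2$, and let $f(X_0,\dots,X_n)\in\mathrm{GF}(q)[X_0,\dots,X_n]$ be a homogeneous polynomial of degree $d<q$. Suppose that there are $n-1$ independent lines $\ell_1,\dots,\ell_{n-1}$ of $\mathrm{PG}(n,q)$, all passing through a common point $P$, each totally contained in the hypersurface $f=0$. Then the hyperplane spanned by $\ell_1,\dots,\ell_{n-1}$ is a tangent hyperplane of $f$.
   Context: A line is totally contained in the hypersurface $f=0$ if $f$ vanishes at all its points over $\mathrm{GF}(q)$. A hyperplane $H$ is a tangent hyperplane of $f$ (at a point $P$ of $f=0$ lying in $H$) if $\sum_{i=0}^n y_i\,\partial_{X_i}f(P)=0$ for every point $(y_0,\dots,y_n)$ of $H$; i.e. either all partial derivatives of $f$ vanish at $P$, or $H=[\partial_{X_0}f(P),\dots,\partial_{X_n}f(P)]$. -}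

module Defs where

open import Level using (Level; _⊔_)
open import Algebra.Bundles using (CommutativeRing)
open import Data.Nat as ℕ using (ℕ; zero; suc; _∸_)
open import Data.Nat.Primality using (Prime)
open import Data.Fin using (Fin; zero; suc; _≟_)
open import Data.List using (List; foldr; map)
open import Data.List.Relation.Unary.All using (All)
open import Data.Product using (_×_; _,_; Σ; ∃; proj₁; proj₂)
open import Relation.Nullary using (¬_; yes; no)
open import Relation.Binary.PropositionalEquality using (_≡_)

IsPrimePower : ℕ → Set
IsPrimePower q = Σ ℕ λ p → Σ ℕ λ k → Prime p × q ≡ p ℕ.^ suc k

sumℕ : ∀ {k} → (Fin k → ℕ) → ℕ
sumℕ {zero}  e = 0
sumℕ {suc k} e = e zero ℕ.+ sumℕ (λ i → e (suc i))

module Over {c ℓ : Level} (R : CommutativeRing c ℓ) where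
  open CommutativeRing R hiding (zero)

  IsField : Set (c ⊔ ℓ)
  IsField = (¬ (0# ≈ 1#)) × (∀ x → ¬ (x ≈ 0#) → ∃ λ y → x * y ≈ 1#)

  HasOrder : ℕ → Set (c ⊔ ℓ)
  HasOrder q = Σ (Fin q → Carrier) λ el →
                 (∀ x → ∃ λ i → el i ≈ x) × (∀ i j → el i ≈ el j → i ≡ j)

  IsGF : ℕ → Set (c ⊔ ℓ)
  IsGF q = IsPrimePower q × IsField × HasOrder q

  pow : Carrier → ℕ → Carrier
  pow x zero    = 1#
  pow x (suc k) = x * pow x k

  natScale : ℕ → Carrier → Carrier
  natScale zero    x = 0#
  natScale (suc k) x = x + natScale k x

  sumF : ∀ {k} → (Fin k → Carrier) → Carrier
  sumF {zero}  v = 0#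
  sumF {suc k} v = v zero + sumF (λ i → v (suc i))

  prodF : ∀ {k} → (Fin k → Carrier) → Carrier
  prodF {zero}  v = 1#
  prodF {suc k} v = v zero * prodF (λ i → v (suc i))

  -- vectors in R^m (homogeneous coordinates)
  Vect : ℕ → Set c
  Vect m = Fin m → Carrier

  -- a polynomial in variables X_0..X_{m-1}: a finite list of terms c·X^e
  Term : ℕ → Set c
  Term m = Carrier × (Fin m → ℕ)

  Poly : ℕ → Set c
  Poly m = List (Term m)

  evalTerm : ∀ {m} → Term m → Vect m → Carrier
  evalTerm (a , e) x = a * prodF (λ i → pow (x i) (e i))

  eval : ∀ {m} → Poly m → Vect m → Carrier
  eval f x = foldr (λ t acc → evalTerm t x + acc) 0# f

  Homogeneous : ∀ {m} → ℕ → Poly m → Set c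
  Homogeneous d f = All (λ t → sumℕ (proj₂ t) ≡ d) f

  derivTerm : ∀ {m} → Fin m → Term m → Term m
  derivTerm j (a , e) = natScale (e j) a , λ i → dec i
    where
    dec : _ → ℕ
    dec i with i ≟ j
    ... | yes _ = e i ∸ 1
    ... | no  _ = e i

  deriv : ∀ {m} → Fin m → Poly m → Poly m
  deriv j f = map (derivTerm j) f

  IsZeroVec : ∀ {m} → Vect m → Set ℓ
  IsZeroVec v = ∀ i → v i ≈ 0#

  linComb : ∀ {k m} → (Fin k → Carrier) → (Fin k → Vect m) → Vect m
  linComb cs vs i = sumF (λ j → cs j * vs j i)

  LinIndep : ∀ {k m} → (Fin k → Vect m) → Set (c ⊔ ℓ)
  LinIndep vs = ∀ cs → IsZeroVec (linComb cs vs) → ∀ j → cs j ≈ 0#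

  InSpan : ∀ {k m} → (Fin k → Vect m) → Vect m → Set (c ⊔ ℓ)
  InSpan vs y = ∃ λ cs → ∀ i → y i ≈ linComb cs vs i

  -- the line through the projective points ⟨u⟩, ⟨v⟩ is totally contained in f = 0:
  -- f vanishes at every point a·u + b·v (a nonzero vector) of the line
  LineContained : ∀ {m} → Poly m → Vect m → Vect m → Set (c ⊔ ℓ)
  LineContained f u v = ∀ a b → ¬ IsZeroVec (λ i → a * u i + b * v i)
                          → eval f (λ i → a * u i + b * v i) ≈ 0#

  TangentAt : ∀ {k m} → Poly m → (Fin k → Vect m) → Vect m → Set (c ⊔ ℓ)
  TangentAt f hs P = ∀ y → InSpan hs y → sumF (λ i → y i * eval (deriv i f) P) ≈ 0#

  IsTangentHyperplane : ∀ {k m} → Poly m → (Fin k → Vect m) → Set (c ⊔ ℓ)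
  IsTangentHyperplane f hs = ∃ λ P → ¬ IsZeroVec P × InSpan hs P × eval f P ≈ 0# × TangentAt f hs P

consV : ∀ {a} {A : Set a} {k} → A → (Fin k → A) → Fin (suc k) → A
consV x xs zero    = x
consV x xs (suc i) = xs i

-- For a direction Y, t ↦ f(P + tY) is a univariate polynomial of degree ≤ d < q whose linear
-- coefficient is ∑ᵢ Yᵢ ∂ᵢf(P). When the line through P in direction Y lies on f = 0, this polynomial
-- has all q elements of GF(q) as roots, so it is zero, and in particular ∑ᵢ Yᵢ ∂ᵢf(P) = 0.
-- The directions Qⱼ and P + Q₁ give lines ℓⱼ and ℓ₁, so the gradient of f at P annihilates P and
-- every Qⱼ, hence their whole span: that span is the tangent hyperplane at the point P.

module Submission where

open import Defs
open import Level using (Level)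
open import Algebra.Bundles using (CommutativeRing)
open import Data.Nat using (ℕ; suc; _∸_; _≤_; _<_)
open import Data.Fin using (Fin; zero; suc)

import Data.Nat as ℕ
open import Data.Nat using (zero; z≤n; s≤s)
open import Data.Nat.Properties using (≤-trans; m≤n+m)
open import Data.Fin.Properties using (0≢1+n; suc-injective)
open import Data.List using (List; []; _∷_; length; map)
open import Data.List.Properties using (length-map)
open import Data.List.Relation.Unary.All using (All; []; _∷_)
open import Data.Product using (_,_; _×_; proj₁; proj₂)
open import Relation.Nullary using (¬_; yes; no)
open import Data.Fin using (_≟_)
open import Function using (_∘_)
open import Relation.Binary.PropositionalEquality as ≡ using (_≡_)

module Sums {c ℓ : Level} (R : CommutativeRing c ℓ) where
  open CommutativeRing R hiding (zero)
  open Over R using (sumF; natScale)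
  open import Algebra.Properties.Semiring.Sum semiring
    using (sum; sum-cong-≋; sum-replicate-zero; ∑-distrib-+; ∑-comm; *-distribˡ-sum)
  import Algebra.Properties.Semiring.Mult semiring as Mult

  sumF≡sum : ∀ {k} (v : Fin k → Carrier) → sumF v ≡ sum v
  sumF≡sum {zero}  v = ≡.refl
  sumF≡sum {suc k} v = ≡.cong (v zero +_) (sumF≡sum (v ∘ suc))

  sumF≈sum : ∀ {k} (v : Fin k → Carrier) → sumF v ≈ sum v
  sumF≈sum v = reflexive (sumF≡sum v)

  sumF-cong : ∀ {k} {u v : Fin k → Carrier} → (∀ i → u i ≈ v i) → sumF u ≈ sumF v
  sumF-cong {u = u} {v} u≈v = trans (sumF≈sum u) (trans (sum-cong-≋ u≈v) (sym (sumF≈sum v)))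

  sumF-zero : ∀ {k} {v : Fin k → Carrier} → (∀ i → v i ≈ 0#) → sumF v ≈ 0#
  sumF-zero {k} v≈0 = trans (sumF-cong v≈0) (trans (sumF≈sum {k} (λ _ → 0#)) (sum-replicate-zero k))

  sumF-distrib-+ : ∀ {k} (u v : Fin k → Carrier) → sumF (λ i → u i + v i) ≈ sumF u + sumF v
  sumF-distrib-+ u v =
    trans (sumF≈sum (λ i → u i + v i)) (trans (∑-distrib-+ u v) (sym (+-cong (sumF≈sum u) (sumF≈sum v))))

  *-distribˡ-sumF : ∀ {k} x (v : Fin k → Carrier) → x * sumF v ≈ sumF (λ i → x * v i)
  *-distribˡ-sumF x v = trans (*-congˡ (sumF≈sum v)) (trans (*-distribˡ-sum x v) (sym (sumF≈sum (λ i → x * v i))))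

  sumF-comm : ∀ {k m} (w : Fin k → Fin m → Carrier) →
              sumF (λ i → sumF (w i)) ≈ sumF (λ j → sumF (λ i → w i j))
  sumF-comm w = trans (double w) (trans (∑-comm w) (sym (double (λ j i → w i j))))
    where
    double : ∀ {k m} (w : Fin k → Fin m → Carrier) → sumF (λ i → sumF (w i)) ≈ sum (λ i → sum (w i))
    double w = trans (sumF-cong (λ i → sumF≈sum (w i))) (sumF≈sum (λ i → sum (w i)))

  natScale≡× : ∀ k x → natScale k x ≡ k Mult.× x
  natScale≡× zero    x = ≡.refl
  natScale≡× (suc k) x = ≡.cong (x +_) (natScale≡× k x)

  natScale-congʳ : ∀ k {x y} → x ≈ y → natScale k x ≈ natScale k y
  natScale-congʳ k {x} {y} x≈y =
    trans (reflexive (natScale≡× k x)) (trans (Mult.×-congʳ k x≈y) (reflexive (≡.sym (natScale≡× k y))))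

  *-natScale : ∀ k x y → x * natScale k y ≈ natScale k (x * y)
  *-natScale k x y =
    trans (*-congˡ (reflexive (natScale≡× k y))) (trans (Mult.×-comm-* k x y) (reflexive (≡.sym (natScale≡× k _))))

  natScale-* : ∀ k x y → natScale k x * y ≈ natScale k (x * y)
  natScale-* k x y =
    trans (*-congʳ (reflexive (natScale≡× k x))) (trans (Mult.×-assoc-* k x y) (reflexive (≡.sym (natScale≡× k _))))

module Linear {c ℓ : Level} (R : CommutativeRing c ℓ) where
  open CommutativeRing R hiding (zero)
  open Over R
  open Sums R
  open import Algebra.Properties.CommutativeSemigroup *-commutativeSemigroup using (x∙yz≈y∙zx)
  open import Relation.Binary.Reasoning.Setoid setoid

  dot : ∀ {m} → Vect m → Vect m → Carrier
  dot u v = sumF (λ i → u i * v i)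

  dot-+ˡ : ∀ {m} (u v w : Vect m) → dot (λ i → u i + v i) w ≈ dot u w + dot v w
  dot-+ˡ u v w = trans (sumF-cong (λ i → distribʳ (w i) (u i) (v i)))
                   (sumF-distrib-+ (λ i → u i * w i) (λ i → v i * w i))

  dot-span : ∀ {k m} (vs : Fin k → Vect m) (w : Vect m) →
             (∀ j → dot (vs j) w ≈ 0#) → ∀ y → InSpan vs y → dot y w ≈ 0#
  dot-span vs w vs⊥w y (cs , y≈Σcv) = begin
    sumF (λ i → y i * w i)
      ≈⟨ sumF-cong (λ i → trans (*-congʳ (y≈Σcv i)) (*-comm _ (w i))) ⟩
    sumF (λ i → w i * sumF (λ j → cs j * vs j i))
      ≈⟨ sumF-cong (λ i → *-distribˡ-sumF (w i) (λ j → cs j * vs j i)) ⟩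
    sumF (λ i → sumF (λ j → w i * (cs j * vs j i)))
      ≈⟨ sumF-comm (λ i j → w i * (cs j * vs j i)) ⟩
    sumF (λ j → sumF (λ i → w i * (cs j * vs j i)))
      ≈⟨ sumF-cong (λ j → sumF-cong (λ i → x∙yz≈y∙zx (w i) (cs j) (vs j i))) ⟩
    sumF (λ j → sumF (λ i → cs j * (vs j i * w i)))
      ≈⟨ sumF-cong (λ j → *-distribˡ-sumF (cs j) (λ i → vs j i * w i)) ⟨
    sumF (λ j → cs j * dot (vs j) w)
      ≈⟨ sumF-zero (λ j → trans (*-congˡ (vs⊥w j)) (zeroʳ (cs j))) ⟩
    0# ∎

  single : ∀ {k} → Fin k → Carrier → Fin k → Carrier
  single zero    b zero    = b
  single zero    b (suc j) = 0#
  single (suc i) b zero    = 0#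
  single (suc i) b (suc j) = single i b j

  single-diag : ∀ {k} (i : Fin k) b → single i b i ≡ b
  single-diag zero    b = ≡.refl
  single-diag (suc i) b = single-diag i b

  sumF-single : ∀ {k} (i : Fin k) b (w : Fin k → Carrier) → sumF (λ j → single i b j * w j) ≈ b * w i
  sumF-single zero    b w = trans (+-congˡ (sumF-zero (λ j → zeroˡ (w (suc j))))) (+-identityʳ _)
  sumF-single (suc i) b w = trans (+-cong (zeroˡ (w zero)) (sumF-single i b (w ∘ suc))) (+-identityˡ _)

  linIndep-pair : ∀ {k m} (P : Vect m) (Q : Fin k → Vect m) → LinIndep (consV P Q) →
                  ∀ j a b → IsZeroVec (λ i → a * P i + b * Q j i) → a ≈ 0# × b ≈ 0#
  linIndep-pair P Q indep j a b aP+bQ≈0 =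
    coeffs≈0 zero , trans (reflexive (≡.sym (single-diag j b))) (coeffs≈0 (suc j))
    where
    coeffs≈0 : ∀ l → consV a (single j b) l ≈ 0#
    coeffs≈0 = indep (consV a (single j b)) (λ i → trans (+-congˡ (sumF-single j b (λ l → Q l i))) (aP+bQ≈0 i))

module Univariate {c ℓ : Level} (R : CommutativeRing c ℓ) where
  open CommutativeRing R hiding (zero)
  open Over R using (pow; natScale)
  open Sums R using (*-natScale; natScale-congʳ)
  open import Algebra.Properties.CommutativeSemigroup *-commutativeSemigroup using (x∙yz≈y∙xz)
  open import Relation.Binary.Reasoning.Setoid setoid
  open import Algebra.Solver.Ring.NaturalCoefficients.Default commutativeSemiring
    using (solve; _:+_; _:*_; _:=_; con)

  -- coefficient lists, constant term first
  UPoly : Set c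
  UPoly = List Carrier

  infixl 6 _+ₚ_
  infixr 7 _•ₚ_ _*ₚ_
  infixl 8 _^ₚ_

  ⟦_⟧ : UPoly → Carrier → Carrier
  ⟦ []    ⟧ t = 0#
  ⟦ a ∷ p ⟧ t = a + t * ⟦ p ⟧ t

  coeff : UPoly → ℕ → Carrier
  coeff []      k       = 0#
  coeff (a ∷ p) zero    = a
  coeff (a ∷ p) (suc k) = coeff p k

  _+ₚ_ : UPoly → UPoly → UPoly
  []      +ₚ q       = q
  (a ∷ p) +ₚ []      = a ∷ p
  (a ∷ p) +ₚ (b ∷ q) = a + b ∷ p +ₚ q

  _•ₚ_ : Carrier → UPoly → UPoly
  a •ₚ p = map (a *_) p

  _*ₚ_ : UPoly → UPoly → UPoly
  []      *ₚ q = []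
  (a ∷ p) *ₚ q = a •ₚ q +ₚ (0# ∷ p *ₚ q)

  _^ₚ_ : UPoly → ℕ → UPoly
  p ^ₚ zero  = 1# ∷ []
  p ^ₚ suc e = p *ₚ p ^ₚ e

  ⟦⟧-const : ∀ a t → ⟦ a ∷ [] ⟧ t ≈ a
  ⟦⟧-const a t = trans (+-congˡ (zeroʳ t)) (+-identityʳ a)

  ⟦⟧-+ₚ : ∀ p q t → ⟦ p +ₚ q ⟧ t ≈ ⟦ p ⟧ t + ⟦ q ⟧ t
  ⟦⟧-+ₚ []      q       t = sym (+-identityˡ _)
  ⟦⟧-+ₚ (a ∷ p) []      t = sym (+-identityʳ _)
  ⟦⟧-+ₚ (a ∷ p) (b ∷ q) t = trans (+-congˡ (*-congˡ (⟦⟧-+ₚ p q t)))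
    (solve 5 (λ a b t x y → (a :+ b) :+ t :* (x :+ y) := (a :+ t :* x) :+ (b :+ t :* y)) refl a b t _ _)

  ⟦⟧-•ₚ : ∀ a p t → ⟦ a •ₚ p ⟧ t ≈ a * ⟦ p ⟧ t
  ⟦⟧-•ₚ a []      t = sym (zeroʳ a)
  ⟦⟧-•ₚ a (b ∷ p) t = trans (+-congˡ (*-congˡ (⟦⟧-•ₚ a p t)))
    (solve 4 (λ a b t x → a :* b :+ t :* (a :* x) := a :* (b :+ t :* x)) refl a b t _)

  ⟦⟧-*ₚ : ∀ p q t → ⟦ p *ₚ q ⟧ t ≈ ⟦ p ⟧ t * ⟦ q ⟧ t
  ⟦⟧-*ₚ []      q t = sym (zeroˡ _)
  ⟦⟧-*ₚ (a ∷ p) q t =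
    trans (⟦⟧-+ₚ (a •ₚ q) (0# ∷ p *ₚ q) t)
      (trans (+-cong (⟦⟧-•ₚ a q t) (trans (+-identityˡ _) (*-congˡ (⟦⟧-*ₚ p q t))))
        (solve 4 (λ a t x y → a :* y :+ t :* (x :* y) := (a :+ t :* x) :* y) refl a t _ _))

  ⟦⟧-^ₚ : ∀ p e t → ⟦ p ^ₚ e ⟧ t ≈ pow (⟦ p ⟧ t) e
  ⟦⟧-^ₚ p zero    t = ⟦⟧-const 1# t
  ⟦⟧-^ₚ p (suc e) t = trans (⟦⟧-*ₚ p (p ^ₚ e) t) (*-congˡ (⟦⟧-^ₚ p e t))

  coeff-+ₚ : ∀ p q k → coeff (p +ₚ q) k ≈ coeff p k + coeff q k
  coeff-+ₚ []      q       k       = sym (+-identityˡ _)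
  coeff-+ₚ (a ∷ p) []      k       = sym (+-identityʳ _)
  coeff-+ₚ (a ∷ p) (b ∷ q) zero    = refl
  coeff-+ₚ (a ∷ p) (b ∷ q) (suc k) = coeff-+ₚ p q k

  coeff-•ₚ : ∀ a p k → coeff (a •ₚ p) k ≈ a * coeff p k
  coeff-•ₚ a []      k       = sym (zeroʳ a)
  coeff-•ₚ a (b ∷ p) zero    = refl
  coeff-•ₚ a (b ∷ p) (suc k) = coeff-•ₚ a p k

  coeff₀-*ₚ : ∀ p q → coeff (p *ₚ q) 0 ≈ coeff p 0 * coeff q 0
  coeff₀-*ₚ []      q = sym (zeroˡ _)
  coeff₀-*ₚ (a ∷ p) q = trans (coeff-+ₚ (a •ₚ q) (0# ∷ p *ₚ q) 0) (trans (+-identityʳ _) (coeff-•ₚ a q 0))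

  coeff₁-*ₚ : ∀ p q → coeff (p *ₚ q) 1 ≈ coeff p 0 * coeff q 1 + coeff p 1 * coeff q 0
  coeff₁-*ₚ []      q = sym (trans (+-cong (zeroˡ _) (zeroˡ _)) (+-identityʳ 0#))
  coeff₁-*ₚ (a ∷ p) q =
    trans (coeff-+ₚ (a •ₚ q) (0# ∷ p *ₚ q) 1) (+-cong (coeff-•ₚ a q 1) (coeff₀-*ₚ p q))

  coeff-All≈0 : ∀ p k → All (_≈ 0#) p → coeff p k ≈ 0#
  coeff-All≈0 []      k       []          = refl
  coeff-All≈0 (a ∷ p) zero    (a≈0 ∷ _)   = a≈0
  coeff-All≈0 (a ∷ p) (suc k) (_ ∷ p≈0)   = coeff-All≈0 p k p≈0

  length-+ₚ : ∀ p q {n} → length p ≤ n → length q ≤ n → length (p +ₚ q) ≤ n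
  length-+ₚ []      q       _         q≤n       = q≤n
  length-+ₚ (a ∷ p) []      p≤n       _         = p≤n
  length-+ₚ (a ∷ p) (b ∷ q) (s≤s p≤n) (s≤s q≤n) = s≤s (length-+ₚ p q p≤n q≤n)

  length-•ₚ : ∀ a p {n} → length p ≤ n → length (a •ₚ p) ≤ n
  length-•ₚ a p = ≡.subst (_≤ _) (≡.sym (length-map (a *_) p))

  length-*ₚ : ∀ p q {i j} → length p ≤ suc i → length q ≤ suc j → length (p *ₚ q) ≤ suc (i ℕ.+ j)
  length-*ₚ []          q         _         _   = z≤n
  length-*ₚ (a ∷ [])    q {i} {j} _         q≤j =
    length-+ₚ (a •ₚ q) (0# ∷ []) (length-•ₚ a q (≤-trans q≤j (s≤s (m≤n+m j i)))) (s≤s z≤n)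
  length-*ₚ (a ∷ b ∷ p) q {suc i} {j} (s≤s p≤i) q≤j =
    length-+ₚ (a •ₚ q) (0# ∷ (b ∷ p) *ₚ q) (length-•ₚ a q (≤-trans q≤j (s≤s (m≤n+m j (suc i)))))
      (s≤s (length-*ₚ (b ∷ p) q p≤i q≤j))

  linear : Carrier → Carrier → UPoly
  linear p y = p ∷ y ∷ []

  ⟦⟧-linear : ∀ p y t → ⟦ linear p y ⟧ t ≈ p + t * y
  ⟦⟧-linear p y t = +-congˡ (*-congˡ (⟦⟧-const y t))

  length-linear^ₚ : ∀ p y e → length (linear p y ^ₚ e) ≤ suc e
  length-linear^ₚ p y zero    = s≤s z≤n
  length-linear^ₚ p y (suc e) = length-*ₚ (linear p y) (linear p y ^ₚ e) (s≤s (s≤s z≤n)) (length-linear^ₚ p y e)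

  coeff₀-linear^ₚ : ∀ p y e → coeff (linear p y ^ₚ e) 0 ≈ pow p e
  coeff₀-linear^ₚ p y zero    = refl
  coeff₀-linear^ₚ p y (suc e) = trans (coeff₀-*ₚ (linear p y) (linear p y ^ₚ e)) (*-congˡ (coeff₀-linear^ₚ p y e))

  coeff₁-linear^ₚ : ∀ p y e → coeff (linear p y ^ₚ e) 1 ≈ natScale e (y * pow p (e ∸ 1))
  coeff₁-linear^ₚ p y zero    = refl
  coeff₁-linear^ₚ p y (suc e) = begin
    coeff (linear p y *ₚ linear p y ^ₚ e) 1
      ≈⟨ coeff₁-*ₚ (linear p y) (linear p y ^ₚ e) ⟩
    p * coeff (linear p y ^ₚ e) 1 + y * coeff (linear p y ^ₚ e) 0
      ≈⟨ +-cong (*-congˡ (coeff₁-linear^ₚ p y e)) (*-congˡ (coeff₀-linear^ₚ p y e)) ⟩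
    p * natScale e (y * pow p (e ∸ 1)) + y * pow p e
      ≈⟨ +-congʳ (raise e) ⟩
    natScale e (y * pow p e) + y * pow p e
      ≈⟨ +-comm _ _ ⟩
    natScale (suc e) (y * pow p e) ∎
    where
    raise : ∀ e → p * natScale e (y * pow p (e ∸ 1)) ≈ natScale e (y * pow p e)
    raise zero    = zeroʳ p
    raise (suc e) = trans (*-natScale (suc e) p _) (natScale-congʳ (suc e) (x∙yz≈y∙xz p y _))

  -- synthetic division by t − r, with remainder ⟦ p ⟧ r
  quotient : Carrier → UPoly → UPoly
  quotient r []          = []
  quotient r (a ∷ [])    = []
  quotient r (a ∷ b ∷ p) = ⟦ b ∷ p ⟧ r ∷ quotient r (b ∷ p)

  -- p(t) − p(r) = (t − r) · quotient r p (t), rearranged so that no subtraction occurs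
  ⟦⟧-quotient : ∀ r p t → ⟦ p ⟧ t + r * ⟦ quotient r p ⟧ t ≈ t * ⟦ quotient r p ⟧ t + ⟦ p ⟧ r
  ⟦⟧-quotient r []          t = solve 2 (λ r t → con 0 :+ r :* con 0 := t :* con 0 :+ con 0) refl r t
  ⟦⟧-quotient r (a ∷ [])    t =
    solve 3 (λ r t a → (a :+ t :* con 0) :+ r :* con 0 := t :* con 0 :+ (a :+ r :* con 0)) refl r t a
  ⟦⟧-quotient r (a ∷ b ∷ p) t = begin
    (a + t * x) + r * (xᵣ + t * q)  ≈⟨ solve 6 (λ a t r x xᵣ q → (a :+ t :* x) :+ r :* (xᵣ :+ t :* q)
                                                 := (a :+ t :* (x :+ r :* q)) :+ r :* xᵣ) refl a t r x xᵣ q ⟩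
    (a + t * (x + r * q)) + r * xᵣ  ≈⟨ +-congʳ (+-congˡ (*-congˡ (⟦⟧-quotient r (b ∷ p) t))) ⟩
    (a + t * (t * q + xᵣ)) + r * xᵣ ≈⟨ solve 6 (λ a t r x xᵣ q → (a :+ t :* (t :* q :+ xᵣ)) :+ r :* xᵣ
                                                 := t :* (xᵣ :+ t :* q) :+ (a :+ r :* xᵣ)) refl a t r x xᵣ q ⟩
    t * (xᵣ + t * q) + (a + r * xᵣ) ∎
    where
    x xᵣ q : Carrier
    x  = ⟦ b ∷ p ⟧ t
    xᵣ = ⟦ b ∷ p ⟧ r
    q  = ⟦ quotient r (b ∷ p) ⟧ t

  length-quotient : ∀ r p {k} → length p ≤ suc k → length (quotient r p) ≤ k
  length-quotient r []          _               = z≤n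
  length-quotient r (a ∷ [])    _               = z≤n
  length-quotient r (a ∷ b ∷ p) {suc k} (s≤s p≤k) = s≤s (length-quotient r (b ∷ p) p≤k)

  quotient-All≈0 : ∀ r p → All (_≈ 0#) (quotient r p) → ⟦ p ⟧ r ≈ 0# → All (_≈ 0#) p
  quotient-All≈0 r []          _            _      = []
  quotient-All≈0 r (a ∷ [])    _            p[r]≈0 = trans (sym (⟦⟧-const a r)) p[r]≈0 ∷ []
  quotient-All≈0 r (a ∷ b ∷ p) (xᵣ≈0 ∷ q≈0) p[r]≈0 =
    trans (sym (trans (+-congˡ (*-congˡ xᵣ≈0)) (⟦⟧-const a r))) p[r]≈0 ∷ quotient-All≈0 r (b ∷ p) q≈0 xᵣ≈0

module Roots {c ℓ : Level} (R : CommutativeRing c ℓ) (isField : Over.IsField R) where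
  open CommutativeRing R hiding (zero)
  open Univariate R
  open import Algebra.Properties.Group +-group using (x∙y⁻¹≈ε⇒x≈y)
  open import Algebra.Properties.CommutativeSemigroup *-commutativeSemigroup using (xy∙z≈y∙xz)
  open import Relation.Binary.Reasoning.Setoid setoid

  x≉0∧x*y≈0⇒y≈0 : ∀ {x y} → x ≉ 0# → x * y ≈ 0# → y ≈ 0#
  x≉0∧x*y≈0⇒y≈0 {x} {y} x≉0 xy≈0 with proj₂ isField x x≉0
  ... | x⁻¹ , xx⁻¹≈1 = begin
    y            ≈⟨ *-identityˡ y ⟨
    1# * y       ≈⟨ *-congʳ xx⁻¹≈1 ⟨
    x * x⁻¹ * y  ≈⟨ xy∙z≈y∙xz x x⁻¹ y ⟩
    x⁻¹ * (x * y) ≈⟨ *-congˡ xy≈0 ⟩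
    x⁻¹ * 0#     ≈⟨ zeroʳ x⁻¹ ⟩
    0#           ∎

  x*z≈y*z∧x≉y⇒z≈0 : ∀ {x y z} → x * z ≈ y * z → x ≉ y → z ≈ 0#
  x*z≈y*z∧x≉y⇒z≈0 {x} {y} {z} xz≈yz x≉y =
    x≉0∧x*y≈0⇒y≈0 (λ x-y≈0 → x≉y (x∙y⁻¹≈ε⇒x≈y x y x-y≈0)) (begin
      (x - y) * z      ≈⟨ distribʳ z x (- y) ⟩
      x * z + - y * z  ≈⟨ +-congʳ xz≈yz ⟩
      y * z + - y * z  ≈⟨ distribʳ z y (- y) ⟨
      (y - y) * z      ≈⟨ *-congʳ (-‿inverseʳ y) ⟩
      0# * z           ≈⟨ zeroˡ z ⟩
      0#               ∎)

  distinctRoots⇒All≈0 : ∀ k p → length p ≤ k → (r : Fin k → Carrier) → (∀ i j → r i ≈ r j → i ≡ j) →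
                        (∀ i → ⟦ p ⟧ (r i) ≈ 0#) → All (_≈ 0#) p
  distinctRoots⇒All≈0 zero    []  _     r r-inj roots = []
  distinctRoots⇒All≈0 (suc k) p   p≤k+1 r r-inj roots =
    quotient-All≈0 r₀ p
      (distinctRoots⇒All≈0 k (quotient r₀ p) (length-quotient r₀ p p≤k+1) (r ∘ suc)
        (λ i j rᵢ≈rⱼ → suc-injective (r-inj (suc i) (suc j) rᵢ≈rⱼ)) quotient-roots)
      (roots zero)
    where
    r₀ : Carrier
    r₀ = r zero

    quotient-roots : ∀ j → ⟦ quotient r₀ p ⟧ (r (suc j)) ≈ 0#
    quotient-roots j = x*z≈y*z∧x≉y⇒z≈0 r₀q≈rⱼq (λ r₀≈rⱼ → 0≢1+n (r-inj zero (suc j) r₀≈rⱼ))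
      where
      rⱼ q : Carrier
      rⱼ = r (suc j)
      q  = ⟦ quotient r₀ p ⟧ rⱼ
      r₀q≈rⱼq : r₀ * q ≈ rⱼ * q
      r₀q≈rⱼq = begin
        r₀ * q              ≈⟨ +-identityˡ (r₀ * q) ⟨
        0# + r₀ * q         ≈⟨ +-congʳ (roots (suc j)) ⟨
        ⟦ p ⟧ rⱼ + r₀ * q   ≈⟨ ⟦⟧-quotient r₀ p rⱼ ⟩
        rⱼ * q + ⟦ p ⟧ r₀   ≈⟨ +-congˡ (roots zero) ⟩
        rⱼ * q + 0#         ≈⟨ +-identityʳ (rⱼ * q) ⟩
        rⱼ * q              ∎

module LineRestriction {c ℓ : Level} (R : CommutativeRing c ℓ) where
  open CommutativeRing R hiding (zero)
  open Over R
  open Sums R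
  open Linear R using (dot)
  open Univariate R
  open import Data.Vec.Functional using (updateAt)
  open import Data.Vec.Functional.Properties using (updateAt-updates; updateAt-minimal)
  open import Algebra.Properties.CommutativeSemigroup *-commutativeSemigroup using (x∙yz≈y∙xz)
  open import Relation.Binary.Reasoning.Setoid setoid

  gradient : ∀ {m} → Poly m → Vect m → Vect m
  gradient f P i = eval (deriv i f) P

  pointOnLine : ∀ {m} → Vect m → Vect m → Carrier → Vect m
  pointOnLine P Y t i = P i + t * Y i

  monomial : ∀ {m} → Vect m → (Fin m → ℕ) → Carrier
  monomial x e = prodF (λ i → pow (x i) (e i))

  lower : ∀ {m} → (Fin m → ℕ) → Fin m → Fin m → ℕ
  lower e j = updateAt e j (_∸ 1)

  pow-cong : ∀ {x y} → x ≈ y → ∀ e → pow x e ≈ pow y e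
  pow-cong x≈y zero    = refl
  pow-cong x≈y (suc e) = *-cong x≈y (pow-cong x≈y e)

  prodF-cong : ∀ {m} {u v : Fin m → Carrier} → (∀ i → u i ≈ v i) → prodF u ≈ prodF v
  prodF-cong {zero}  u≈v = refl
  prodF-cong {suc m} u≈v = *-cong (u≈v zero) (prodF-cong (u≈v ∘ suc))

  eval-cong : ∀ {m} (f : Poly m) {x y : Vect m} → (∀ i → x i ≈ y i) → eval f x ≈ eval f y
  eval-cong []            x≈y = refl
  eval-cong ((a , e) ∷ f) x≈y =
    +-cong (*-congˡ (prodF-cong (λ i → pow-cong (x≈y i) (e i)))) (eval-cong f x≈y)

  derivTerm-exponent : ∀ {m} (j : Fin m) a e i → proj₂ (derivTerm j (a , e)) i ≡ lower e j i
  derivTerm-exponent j a e i with i ≟ j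
  ... | yes ≡.refl = ≡.sym (updateAt-updates i e)
  ... | no  i≢j    = ≡.sym (updateAt-minimal i j e i≢j)

  evalTerm-derivTerm : ∀ {m} (j : Fin m) a e (x : Vect m) →
                       evalTerm (derivTerm j (a , e)) x ≈ natScale (e j) (a * monomial x (lower e j))
  evalTerm-derivTerm j a e x = trans (natScale-* (e j) a _)
    (natScale-congʳ (e j) (*-congˡ (prodF-cong (λ i → reflexive (≡.cong (pow (x i)) (derivTerm-exponent j a e i))))))

  restrictMonomial : ∀ {m} → Vect m → Vect m → (Fin m → ℕ) → UPoly
  restrictMonomial {zero}  P Y e = 1# ∷ []
  restrictMonomial {suc m} P Y e =
    linear (P zero) (Y zero) ^ₚ e zero *ₚ restrictMonomial (P ∘ suc) (Y ∘ suc) (e ∘ suc)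

  restrict : ∀ {m} → Vect m → Vect m → Poly m → UPoly
  restrict P Y []            = []
  restrict P Y ((a , e) ∷ f) = a •ₚ restrictMonomial P Y e +ₚ restrict P Y f

  ⟦⟧-restrictMonomial : ∀ {m} (P Y : Vect m) e t → ⟦ restrictMonomial P Y e ⟧ t ≈ monomial (pointOnLine P Y t) e
  ⟦⟧-restrictMonomial {zero}  P Y e t = ⟦⟧-const 1# t
  ⟦⟧-restrictMonomial {suc m} P Y e t =
    trans (⟦⟧-*ₚ (linear (P zero) (Y zero) ^ₚ e zero) (restrictMonomial (P ∘ suc) (Y ∘ suc) (e ∘ suc)) t)
      (*-cong (trans (⟦⟧-^ₚ (linear (P zero) (Y zero)) (e zero) t) (pow-cong (⟦⟧-linear (P zero) (Y zero) t) (e zero)))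
              (⟦⟧-restrictMonomial (P ∘ suc) (Y ∘ suc) (e ∘ suc) t))

  ⟦⟧-restrict : ∀ {m} (P Y : Vect m) f t → ⟦ restrict P Y f ⟧ t ≈ eval f (pointOnLine P Y t)
  ⟦⟧-restrict P Y []            t = refl
  ⟦⟧-restrict P Y ((a , e) ∷ f) t = trans (⟦⟧-+ₚ (a •ₚ restrictMonomial P Y e) (restrict P Y f) t)
    (+-cong (trans (⟦⟧-•ₚ a (restrictMonomial P Y e) t) (*-congˡ (⟦⟧-restrictMonomial P Y e t)))
            (⟦⟧-restrict P Y f t))

  length-restrictMonomial : ∀ {m} (P Y : Vect m) e → length (restrictMonomial P Y e) ≤ suc (sumℕ e)
  length-restrictMonomial {zero}  P Y e = s≤s z≤n
  length-restrictMonomial {suc m} P Y e =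
    length-*ₚ (linear (P zero) (Y zero) ^ₚ e zero) (restrictMonomial (P ∘ suc) (Y ∘ suc) (e ∘ suc))
      (length-linear^ₚ (P zero) (Y zero) (e zero)) (length-restrictMonomial (P ∘ suc) (Y ∘ suc) (e ∘ suc))

  length-restrict : ∀ {m} (P Y : Vect m) {d} f → Homogeneous d f → length (restrict P Y f) ≤ suc d
  length-restrict P Y []            []              = z≤n
  length-restrict P Y ((a , e) ∷ f) (deg≡d ∷ hom) =
    length-+ₚ (a •ₚ restrictMonomial P Y e) (restrict P Y f)
      (length-•ₚ a (restrictMonomial P Y e) (≡.subst (λ n → _ ≤ suc n) deg≡d (length-restrictMonomial P Y e)))
      (length-restrict P Y f hom)

  coeff₀-restrictMonomial : ∀ {m} (P Y : Vect m) e → coeff (restrictMonomial P Y e) 0 ≈ monomial P e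
  coeff₀-restrictMonomial {zero}  P Y e = refl
  coeff₀-restrictMonomial {suc m} P Y e =
    trans (coeff₀-*ₚ (linear (P zero) (Y zero) ^ₚ e zero) (restrictMonomial (P ∘ suc) (Y ∘ suc) (e ∘ suc)))
      (*-cong (coeff₀-linear^ₚ (P zero) (Y zero) (e zero)) (coeff₀-restrictMonomial (P ∘ suc) (Y ∘ suc) (e ∘ suc)))

  coeff₁-restrictMonomial : ∀ {m} (P Y : Vect m) e →
    coeff (restrictMonomial P Y e) 1 ≈ sumF (λ j → natScale (e j) (Y j * monomial P (lower e j)))
  coeff₁-restrictMonomial {zero}  P Y e = refl
  coeff₁-restrictMonomial {suc m} P Y e = begin
    coeff (L *ₚ M) 1
      ≈⟨ coeff₁-*ₚ L M ⟩
    coeff L 0 * coeff M 1 + coeff L 1 * coeff M 0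
      ≈⟨ +-cong (*-cong (coeff₀-linear^ₚ p₀ y₀ e₀) (coeff₁-restrictMonomial P′ Y′ e′))
                (*-cong (coeff₁-linear^ₚ p₀ y₀ e₀) (coeff₀-restrictMonomial P′ Y′ e′)) ⟩
    pow p₀ e₀ * sumF (λ j → natScale (e′ j) (Y′ j * monomial P′ (lower e′ j)))
      + natScale e₀ (y₀ * pow p₀ (e₀ ∸ 1)) * monomial P′ e′
      ≈⟨ +-comm _ _ ⟩
    natScale e₀ (y₀ * pow p₀ (e₀ ∸ 1)) * monomial P′ e′
      + pow p₀ e₀ * sumF (λ j → natScale (e′ j) (Y′ j * monomial P′ (lower e′ j)))
      ≈⟨ +-cong lowered-at-0 lowered-elsewhere ⟩
    sumF (λ j → natScale (e j) (Y j * monomial P (lower e j))) ∎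
    where
    p₀ y₀ : Carrier
    p₀ = P zero
    y₀ = Y zero
    e₀ : ℕ
    e₀ = e zero
    P′ Y′ : Vect m
    P′ = P ∘ suc
    Y′ = Y ∘ suc
    e′ : Fin m → ℕ
    e′ = e ∘ suc
    L M : UPoly
    L = linear p₀ y₀ ^ₚ e₀
    M = restrictMonomial P′ Y′ e′

    lowered-at-0 : natScale e₀ (y₀ * pow p₀ (e₀ ∸ 1)) * monomial P′ e′ ≈ natScale e₀ (y₀ * monomial P (lower e zero))
    lowered-at-0 = trans (natScale-* e₀ (y₀ * pow p₀ (e₀ ∸ 1)) _) (natScale-congʳ e₀ (*-assoc y₀ _ _))

    lowered-elsewhere : pow p₀ e₀ * sumF (λ j → natScale (e′ j) (Y′ j * monomial P′ (lower e′ j))) ≈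
                        sumF (λ j → natScale (e′ j) (Y′ j * monomial P (lower e (suc j))))
    lowered-elsewhere =
      trans (*-distribˡ-sumF (pow p₀ e₀) (λ j → natScale (e′ j) (Y′ j * monomial P′ (lower e′ j))))
        (sumF-cong λ j → trans (*-natScale (e′ j) (pow p₀ e₀) _) (natScale-congʳ (e′ j) (x∙yz≈y∙xz _ (Y′ j) _)))

  coeff₁-restrict : ∀ {m} (P Y : Vect m) f → coeff (restrict P Y f) 1 ≈ dot Y (gradient f P)
  coeff₁-restrict P Y []            = sym (sumF-zero (λ i → zeroʳ (Y i)))
  coeff₁-restrict P Y ((a , e) ∷ f) = begin
    coeff (a •ₚ restrictMonomial P Y e +ₚ restrict P Y f) 1
      ≈⟨ coeff-+ₚ (a •ₚ restrictMonomial P Y e) (restrict P Y f) 1 ⟩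
    coeff (a •ₚ restrictMonomial P Y e) 1 + coeff (restrict P Y f) 1
      ≈⟨ +-cong term (coeff₁-restrict P Y f) ⟩
    dot Y (λ j → evalTerm (derivTerm j (a , e)) P) + dot Y (gradient f P)
      ≈⟨ sumF-distrib-+ (λ j → Y j * evalTerm (derivTerm j (a , e)) P) (λ j → Y j * gradient f P j) ⟨
    sumF (λ j → Y j * evalTerm (derivTerm j (a , e)) P + Y j * gradient f P j)
      ≈⟨ sumF-cong (λ j → distribˡ (Y j) _ _) ⟨
    dot Y (gradient ((a , e) ∷ f) P) ∎
    where
    term : coeff (a •ₚ restrictMonomial P Y e) 1 ≈ dot Y (λ j → evalTerm (derivTerm j (a , e)) P)
    term = begin
      coeff (a •ₚ restrictMonomial P Y e) 1
        ≈⟨ coeff-•ₚ a (restrictMonomial P Y e) 1 ⟩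
      a * coeff (restrictMonomial P Y e) 1
        ≈⟨ *-congˡ (coeff₁-restrictMonomial P Y e) ⟩
      a * sumF (λ j → natScale (e j) (Y j * monomial P (lower e j)))
        ≈⟨ *-distribˡ-sumF a (λ j → natScale (e j) (Y j * monomial P (lower e j))) ⟩
      sumF (λ j → a * natScale (e j) (Y j * monomial P (lower e j)))
        ≈⟨ sumF-cong (λ j → begin
             a * natScale (e j) (Y j * monomial P (lower e j))   ≈⟨ *-natScale (e j) a _ ⟩
             natScale (e j) (a * (Y j * monomial P (lower e j))) ≈⟨ natScale-congʳ (e j) (x∙yz≈y∙xz a (Y j) _) ⟩
             natScale (e j) (Y j * (a * monomial P (lower e j))) ≈⟨ *-natScale (e j) (Y j) _ ⟨
             Y j * natScale (e j) (a * monomial P (lower e j))   ≈⟨ *-congˡ (evalTerm-derivTerm j a e P) ⟨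
             Y j * evalTerm (derivTerm j (a , e)) P              ∎) ⟩
      dot Y (λ j → evalTerm (derivTerm j (a , e)) P) ∎

module Tangency {c ℓ : Level} (R : CommutativeRing c ℓ) where
  open CommutativeRing R hiding (zero)
  open Over R
  open Sums R
  open Univariate R
  open Linear R
  open LineRestriction R
  open import Algebra.Solver.Ring.NaturalCoefficients.Default commutativeSemiring
    using (solve; _:+_; _:*_; _:=_; con)
  open import Relation.Binary.Reasoning.Setoid setoid

  vanishingLine⇒dot-gradient≈0 : ∀ {m q d} → IsField → HasOrder q → d < q → (f : Poly m) → Homogeneous d f →
                                 (P Y : Vect m) → (∀ t → eval f (pointOnLine P Y t) ≈ 0#) →
                                 dot Y (gradient f P) ≈ 0#
  vanishingLine⇒dot-gradient≈0 {q = q} isField (el , _ , el-inj) d<q f hom P Y vanishes = begin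
    dot Y (gradient f P)       ≈⟨ coeff₁-restrict P Y f ⟨
    coeff (restrict P Y f) 1   ≈⟨ coeff-All≈0 (restrict P Y f) 1 restriction≈0 ⟩
    0#                         ∎
    where
    restriction≈0 : All (_≈ 0#) (restrict P Y f)
    restriction≈0 = Roots.distinctRoots⇒All≈0 R isField q (restrict P Y f)
      (≤-trans (length-restrict P Y f hom) d<q) el el-inj
      (λ i → trans (⟦⟧-restrict P Y f (el i)) (vanishes (el i)))

  linesThroughPoint⇒tangentHyperplane : ∀ {m k} q → IsGF q → (d : ℕ) (f : Poly m) → Homogeneous d f → d < q →
                      (P : Vect m) (Q : Fin k → Vect m) → Fin k → LinIndep (consV P Q) →
                      (∀ j → LineContained f P (Q j)) → IsTangentHyperplane f (consV P Q)
  -- only |R| = q is used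
  linesThroughPoint⇒tangentHyperplane {m} q (_ , isField , order) d f hom d<q P Q j₀ indep lines =
    P , P≉0 , P∈span , f[P]≈0 , dot-span (consV P Q) ∇ generators⊥∇
    where
    ∇ : Vect m
    ∇ = gradient f P

    1≉0 : 1# ≉ 0#
    1≉0 1≈0 = proj₁ isField (sym 1≈0)

    linePoint≉0 : ∀ j a b → ¬ (a ≈ 0# × b ≈ 0#) → ¬ IsZeroVec (λ i → a * P i + b * Q j i)
    linePoint≉0 j a b not-both-0 = not-both-0 ∘ linIndep-pair P Q indep j a b

    direction⊥∇ : ∀ Y j (a b : Carrier → Carrier) → (∀ t → ¬ (a t ≈ 0# × b t ≈ 0#)) →
                  (∀ t i → P i + t * Y i ≈ a t * P i + b t * Q j i) → dot Y ∇ ≈ 0#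
    direction⊥∇ Y j a b not-both-0 onLine =
      vanishingLine⇒dot-gradient≈0 isField order d<q f hom P Y λ t →
        trans (eval-cong f (onLine t)) (lines j (a t) (b t) (linePoint≉0 j (a t) (b t) (not-both-0 t)))

    Q⊥∇ : ∀ j → dot (Q j) ∇ ≈ 0#
    Q⊥∇ j = direction⊥∇ (Q j) j (λ _ → 1#) (λ t → t) (λ _ → 1≉0 ∘ proj₁)
      (λ t i → +-congʳ (sym (*-identityˡ (P i))))

    P+Q⊥∇ : dot (λ i → P i + Q j₀ i) ∇ ≈ 0#
    P+Q⊥∇ = direction⊥∇ (λ i → P i + Q j₀ i) j₀ (λ t → 1# + t) (λ t → t)
      (λ t (1+t≈0 , t≈0) → 1≉0 (trans (sym (+-identityʳ 1#)) (trans (+-congˡ (sym t≈0)) 1+t≈0)))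
      (λ t i → solve 3 (λ t p y → p :+ t :* (p :+ y) := (con 1 :+ t) :* p :+ t :* y) refl t (P i) (Q j₀ i))

    P⊥∇ : dot P ∇ ≈ 0#
    P⊥∇ = begin
      dot P ∇                            ≈⟨ +-identityʳ (dot P ∇) ⟨
      dot P ∇ + 0#                       ≈⟨ +-congˡ (Q⊥∇ j₀) ⟨
      dot P ∇ + dot (Q j₀) ∇             ≈⟨ dot-+ˡ P (Q j₀) ∇ ⟨
      dot (λ i → P i + Q j₀ i) ∇         ≈⟨ P+Q⊥∇ ⟩
      0#                                 ∎

    generators⊥∇ : ∀ j → dot (consV P Q j) ∇ ≈ 0#
    generators⊥∇ zero    = P⊥∇
    generators⊥∇ (suc j) = Q⊥∇ j

    1P+0Q≈P : ∀ i → 1# * P i + 0# * Q j₀ i ≈ P i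
    1P+0Q≈P i = trans (+-cong (*-identityˡ (P i)) (zeroˡ (Q j₀ i))) (+-identityʳ (P i))

    P≉0 : ¬ IsZeroVec P
    P≉0 P≈0 = linePoint≉0 j₀ 1# 0# (1≉0 ∘ proj₁) (λ i → trans (1P+0Q≈P i) (P≈0 i))

    P∈span : InSpan (consV P Q) P
    P∈span = consV 1# (λ _ → 0#) , λ i →
      sym (trans (+-cong (*-identityˡ (P i)) (sumF-zero (λ j → zeroˡ (Q j i)))) (+-identityʳ (P i)))

    f[P]≈0 : eval f P ≈ 0#
    f[P]≈0 = trans (eval-cong f (sym ∘ 1P+0Q≈P)) (lines j₀ 1# 0# (linePoint≉0 j₀ 1# 0# (1≉0 ∘ proj₁)))

lemma4 : ∀ {c ℓ : Level} (R : CommutativeRing c ℓ) → let open Over R in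
         (q : ℕ) → IsGF q →
         (n : ℕ) → 2 ≤ n →
         (d : ℕ) → (f : Poly (suc n)) → Homogeneous d f → d < q →
         (P : Vect (suc n)) → (Q : Fin (n ∸ 1) → Vect (suc n)) →
         LinIndep (consV P Q) →
         (∀ i → LineContained f P (Q i)) →
         IsTangentHyperplane f (consV P Q)
lemma4 R q gf (suc (suc n)) (s≤s (s≤s z≤n)) d f hom d<q P Q indep lines =
  Tangency.linesThroughPoint⇒tangentHyperplane R q gf d f hom d<q P Q zero indep lines
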